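{- For every integer $k\ge 3$, $\pi(x_{2k,1})\ge 4k+3$ and $\pi(x_{2k+1,1})\ge 4k+4$.
   Context: Define an infinite integer matrix $(m_{i,j})_{i,j\ge1}$ by: $m_{1,1}=3$, $m_{1,j}=0$ for $j\ge2$; $m_{2,1}=1$, $m_{2,2}=3^4$, $m_{2,j}=0$ for $j\ge3$; $m_{3,1}=0$, $m_{3,2}=2\cdot3^3$, $m_{3,3}=3^7$, $m_{3,j}=0$ for $j\ge4$; $m_{i,1}=0$ for $i\ge4$; and $m_{i,j}=m_{i-3,j-1}+9m_{i-2,j-1}+27m_{i-1,j-1}$ for $i\ge4$, $j\ge2$. Set $a_{i,j}=9m_{4i+1,i+j}+m_{4i,i+j}$ and $b_{i,j}=m_{4i-1,i+j}+9m_{4i,i+j}$ for $i,j\ge1$. Define $(x_{i,j})_{i,j\ge1}$ by $x_{1,1}=3$, $x_{1,j}=0$ for $j\ge2$, and for $k\ge1$: $x_{2k,j}=\sum_{i\ge1}x_{2k-1,i}b_{i,j}$, $x_{2k+1,j}=\sum_{i\ge1}x_{2k,i}a_{i,j}$ (these sums are finite). For an integer $n$, $\pi(n)$ denotes the 3-adic valuation of $n$, with $\pi(0)=\infty$. -}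

module Defs where

open import Data.Nat using (ℕ; zero; suc; _+_; _*_; _∸_)
open import Data.Bool using (Bool; true; false; if_then_else_)

-- All indices are 1-based, as in the paper; index 0 is outside the
-- paper's domain and is given the (irrelevant) value 0.
-- All entries of m, a, b, x are non-negative integers, so ℕ is used.

m : ℕ → ℕ → ℕ
m 1 1 = 3
m 1 _ = 0
m 2 1 = 1
m 2 2 = 81                 -- 3^4
m 2 _ = 0
m 3 1 = 0
m 3 2 = 54                 -- 2 * 3^3
m 3 3 = 2187               -- 3^7
m 3 _ = 0
m (suc (suc (suc (suc i)))) 1 = 0
m (suc (suc (suc (suc i)))) (suc (suc j)) =
  m (suc i) (suc j) + 9 * m (suc (suc i)) (suc j)
    + 27 * m (suc (suc (suc i))) (suc j)
m _ _ = 0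

a : ℕ → ℕ → ℕ
a i j = 9 * m (4 * i + 1) (i + j) + m (4 * i) (i + j)

b : ℕ → ℕ → ℕ
b i j = m (4 * i ∸ 1) (i + j) + 9 * m (4 * i) (i + j)

sum1 : ℕ → (ℕ → ℕ) → ℕ
sum1 zero    f = 0
sum1 (suc N) f = sum1 N f + f (suc N)

odd : ℕ → Bool
odd zero          = false
odd (suc zero)    = true
odd (suc (suc n)) = odd n

-- The paper's sum over all i ≥ 1 is truncated at i = 3j+1: for i > 3j+1 one
-- has a_{i,j} = b_{i,j} = 0 (m_{r,s} = 0 whenever r > 3s), so this is the
-- same (finite) sum.
x : ℕ → ℕ → ℕ
x zero _ = 0
x 1 1 = 3
x 1 _ = 0
x (suc (suc n)) j =
  sum1 (3 * j + 1)
    (λ i → x (suc n) i * (if odd (suc n) then b i j else a i j))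

-- π(n) ≥ e  (3-adic valuation, with π(0) = ∞) is exactly 3^e ∣ n.

-- Every entry m_{i,j} has 3-adic valuation at least (9j − 3i − 3)/2, by induction along its
-- recurrence; hence π(a_{i,j}) ≥ (9j − 3i − 3)/2 and π(b_{i,j}) ≥ (9j − 3i)/2. Multiplying
-- row n by a or b then preserves an invariant of the form
--   π(x_{n,1}) ≥ p   and   π(x_{n,i}) ≥ (9i + q − c)/2 for i ≥ 2,
-- with c = 9 on even rows and c = 6 on odd rows: an a-step raises p by 1, a b-step raises p by
-- up to 4 and q by 8, as long as p stays within what the bound on x_{n,2} allows. From row 6
-- on (p = 15, q = 24) this gives p = 4k + 3 on row 2k and p = 4k + 4 on row 2k + 1, q = 8k.
module Submission where

open import Defs
open import Data.Nat using (ℕ; zero; suc; _+_; _*_; _^_; _∸_; _≤_; _≤?_; _≤ᵇ_; z≤n; s≤s; s≤s⁻¹)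
open import Data.Nat.Properties
open import Data.Nat.Divisibility
open import Data.Nat.Tactic.RingSolver using (solve)
open import Data.List using ([]; _∷_)
open import Data.Product using (_×_; _,_; ∃-syntax)
open import Data.Bool using (true; false; T)
open import Function using (_∘_)
open import Relation.Nullary using (yes; no)
open import Relation.Binary.PropositionalEquality

≤-by-identity : ∀ {m n} k → m + k ≡ n → m ≤ n
≤-by-identity {m} k refl = m≤m+n m k

≤-by-certificate : ∀ {X Y P Q} → P ≤ Q → ∀ k → X + Q + k ≡ Y + P → X ≤ Y
≤-by-certificate {X} {Y} {P} {Q} P≤Q k eq =
  +-cancelʳ-≤ Q X Y (≤-trans (≤-by-identity k eq) (+-monoʳ-≤ Y P≤Q))

halve : ∀ d → ∃[ h ] 2 * h ≤ d × d ≤ suc (2 * h)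
halve zero = 0 , z≤n , z≤n
halve (suc zero) = 0 , z≤n , s≤s z≤n
halve (suc (suc d)) with halve d
... | h , lo , hi = suc h , subst (_≤ 2 + d) (sym (*-suc 2 h)) (s≤s (s≤s lo))
                          , subst (λ n → 2 + d ≤ suc n) (sym (*-suc 2 h)) (s≤s (s≤s hi))

^-monoʳ-∣ : ∀ m {e f} → e ≤ f → m ^ e ∣ m ^ f
^-monoʳ-∣ m {e} e≤f with m≤n⇒∃[o]m+o≡n e≤f
... | o , refl = divides (m ^ o) (trans (^-distribˡ-+-* m e o) (*-comm (m ^ e) (m ^ o)))

^-+-∣-* : ∀ m {e f u v} → m ^ e ∣ u → m ^ f ∣ v → m ^ (e + f) ∣ u * v
^-+-∣-* m {e} {f} d₁ d₂ = subst (_∣ _) (sym (^-distribˡ-+-* m e f)) (*-pres-∣ d₁ d₂)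

-- ValBound s t n: the 3-adic valuation of n is at least (t − s) / 2.
record ValBound (s t n : ℕ) : Set where
  field 3^∣ : ∀ e → 2 * e + s ≤ t → 3 ^ e ∣ n
open ValBound

valBound-0 : ∀ {s t} → ValBound s t 0
3^∣ valBound-0 e _ = (3 ^ e) ∣0

∣⇒valBound : ∀ p {n} → 3 ^ p ∣ n → ValBound 0 (suc (2 * p)) n
3^∣ (∣⇒valBound p d) e 2e≤1+2p = ∣-trans (^-monoʳ-∣ 3 e≤p) d
  where
  e≤p : e ≤ p
  e≤p = s≤s⁻¹ (*-cancelˡ-< 2 e (suc p)
          (≤-trans (s≤s (≤-trans (≤-reflexive (sym (+-identityʳ (2 * e)))) 2e≤1+2p))
                   (≤-reflexive (sym (*-suc 2 p)))))

valBound-weaken : ∀ {s t s′ t′ n} → ValBound s t n → t′ + s ≤ t + s′ → ValBound s′ t′ n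
3^∣ (valBound-weaken {s} {t} {s′} {t′} B h) e h′ = 3^∣ B e (+-cancelʳ-≤ s′ (2 * e + s) t (begin
  2 * e + s + s′   ≡⟨ solve (e ∷ s ∷ s′ ∷ []) ⟩
  2 * e + s′ + s   ≤⟨ +-monoˡ-≤ s h′ ⟩
  t′ + s           ≤⟨ h ⟩
  t + s′           ∎))
  where open ≤-Reasoning

valBound-+ : ∀ {s t u v} → ValBound s t u → ValBound s t v → ValBound s t (u + v)
3^∣ (valBound-+ U V) e h = ∣m∣n⇒∣m+n (3^∣ U e h) (3^∣ V e h)

-- Half-integral bounds lose at most 1/2 under multiplication: split e at ⌊(t₁ − s₁)/2⌋.
valBound-* : ∀ {s₁ t₁ s₂ t₂ u v} → ValBound s₁ t₁ u → ValBound s₂ t₂ v →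
             ValBound (suc (s₁ + s₂)) (t₁ + t₂) (u * v)
3^∣ (valBound-* {s₁} {t₁} {s₂} {t₂} {u} {v} U V) e h with s₁ ≤? t₁
... | no s₁≰t₁ = ∣n⇒∣m*n u (3^∣ V e (≤-by-certificate (+-mono-≤ h (≰⇒> s₁≰t₁)) 2
                   (solve (e ∷ s₁ ∷ s₂ ∷ t₁ ∷ t₂ ∷ []))))
... | yes s₁≤t₁ with m≤n⇒∃[o]m+o≡n s₁≤t₁
...   | d , refl with halve d
...     | h₁ , lo , hi with e ≤? h₁
...       | yes e≤h₁ = ∣m⇒∣m*n v (3^∣ U e
                         (≤-by-certificate (≤-trans (*-mono-≤ (≤-refl {2}) e≤h₁) lo) 0
                           (solve (e ∷ s₁ ∷ d ∷ []))))
...       | no e≰h₁ with m≤n⇒∃[o]m+o≡n (≰⇒≥ e≰h₁)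
...         | r , refl = ^-+-∣-* 3 {h₁} {r}
                           (3^∣ U h₁ (≤-by-certificate lo 0 (solve (h₁ ∷ s₁ ∷ d ∷ []))))
                           (3^∣ V r (≤-by-certificate (+-mono-≤ h hi) 0
                             (solve (h₁ ∷ r ∷ s₁ ∷ s₂ ∷ d ∷ t₂ ∷ []))))

sum1-∣ : ∀ N f {d} → (∀ i → d ∣ f (suc i)) → d ∣ sum1 N f
sum1-∣ zero _ {d} _ = d ∣0
sum1-∣ (suc N) f D = ∣m∣n⇒∣m+n (sum1-∣ N f D) (D N)

valBound-m : ∀ i j → ValBound (3 + 3 * i) (9 * j) (m i j)
valBound-m 1 1 = valBound-weaken (∣⇒valBound 1 ∣-refl) ≤-refl
valBound-m 2 1 = valBound-weaken (∣⇒valBound 0 ∣-refl) (n≤1+n _)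
valBound-m 2 2 = valBound-weaken (∣⇒valBound 4 ∣-refl) ≤-refl
valBound-m 3 2 = valBound-weaken (∣⇒valBound 3 (divides 2 refl)) (n≤1+n _)
valBound-m 3 3 = valBound-weaken (∣⇒valBound 7 ∣-refl) ≤-refl
valBound-m (suc (suc (suc (suc i)))) (suc (suc j)) =
  valBound-+ (valBound-+
    (valBound-weaken (valBound-m (suc i) (suc j)) (≤-by-identity 0 (solve (i ∷ j ∷ []))))
    (valBound-weaken (valBound-* (∣⇒valBound 2 ∣-refl) (valBound-m (suc (suc i)) (suc j)))
      (≤-by-identity 1 (solve (i ∷ j ∷ [])))))
    (valBound-weaken (valBound-* (∣⇒valBound 3 ∣-refl) (valBound-m (suc (suc (suc i))) (suc j)))
      (≤-by-identity 0 (solve (i ∷ j ∷ []))))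
valBound-m 0 _ = valBound-0
valBound-m 1 0 = valBound-0
valBound-m 1 (suc (suc _)) = valBound-0
valBound-m 2 0 = valBound-0
valBound-m 2 (suc (suc (suc _))) = valBound-0
valBound-m 3 0 = valBound-0
valBound-m 3 1 = valBound-0
valBound-m 3 (suc (suc (suc (suc _)))) = valBound-0
valBound-m (suc (suc (suc (suc _)))) 0 = valBound-0
valBound-m (suc (suc (suc (suc _)))) 1 = valBound-0

valBound-a : ∀ i j → ValBound (3 + 3 * i) (9 * j) (a i j)
valBound-a i j = valBound-+
  (valBound-weaken (valBound-* (∣⇒valBound 2 ∣-refl) (valBound-m (4 * i + 1) (i + j)))
    (≤-by-identity 1 (solve (i ∷ j ∷ []))))
  (valBound-weaken (valBound-m (4 * i) (i + j)) (≤-by-identity 0 (solve (i ∷ j ∷ []))))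

-- b is only used for i ≥ 1, where 4i ∸ 1 does not truncate.
valBound-b : ∀ i j → ValBound (3 * suc i) (9 * j) (b (suc i) j)
valBound-b i j = valBound-+
  (subst (λ r → ValBound (3 * suc i) (9 * j) (m r (suc i + j))) (sym (cong (_∸ 1) (*-suc 4 i)))
    (valBound-weaken (valBound-m (3 + 4 * i) (suc i + j)) (≤-by-identity 0 (solve (i ∷ j ∷ [])))))
  (valBound-weaken (valBound-* (∣⇒valBound 2 ∣-refl) (valBound-m (4 * suc i) (suc i + j)))
    (≤-by-identity 1 (solve (i ∷ j ∷ []))))

∣-x-a-step : ∀ n j {d} → odd (suc n) ≡ false →
             (∀ i → d ∣ x (suc n) (suc i) * a (suc i) j) → d ∣ x (suc (suc n)) j
∣-x-a-step n j even D rewrite even = sum1-∣ (3 * j + 1) (λ i → x (suc n) i * a i j) D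

∣-x-b-step : ∀ n j {d} → odd (suc n) ≡ true →
             (∀ i → d ∣ x (suc n) (suc i) * b (suc i) j) → d ∣ x (suc (suc n)) j
∣-x-b-step n j odd D rewrite odd = sum1-∣ (3 * j + 1) (λ i → x (suc n) i * b i j) D

record RowBound (c n p q : ℕ) : Set where
  field
    head : 3 ^ p ∣ x n 1
    tail : ∀ i → ValBound c (9 * suc (suc i) + q) (x n (suc (suc i)))
open RowBound

a-step : ∀ {n p q p′} → odd (suc n) ≡ false → RowBound 9 (suc n) p q →
         q ≤ 2 * p → p′ ≤ suc p → 2 * p′ + 9 ≤ 18 + q → RowBound 6 (suc (suc n)) p′ q
head (a-step {n} {p} {q} {p′} even row q≤2p p′≤1+p 2p′+9≤18+q) = ∣-x-a-step n 1 even term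
  where
  term : ∀ i → 3 ^ p′ ∣ x (suc n) (suc i) * a (suc i) 1
  term zero = 3^∣ (valBound-* (∣⇒valBound p (head row)) (∣⇒valBound 1 (divides 7 refl))) p′
    (≤-by-certificate (*-mono-≤ (≤-refl {2}) p′≤1+p) 1 (solve (p ∷ p′ ∷ [])))
  term (suc i) = ∣m⇒∣m*n _ (3^∣ (tail row i) p′
    (≤-by-certificate 2p′+9≤18+q (9 * i) (solve (i ∷ p′ ∷ q ∷ []))))
3^∣ (tail (a-step {n} {p} {q} even row q≤2p _ _) j) e h =
  ∣-x-a-step n (suc (suc j)) even λ i → 3^∣ (term i) e h
  where
  term : ∀ i → ValBound 6 (9 * suc (suc j) + q) (x (suc n) (suc i) * a (suc i) (suc (suc j)))
  term zero = valBound-weaken (valBound-* (∣⇒valBound p (head row)) (valBound-a 1 (suc (suc j))))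
    (≤-by-certificate q≤2p 0 (solve (j ∷ p ∷ q ∷ [])))
  term (suc i) = valBound-weaken (valBound-* (tail row i) (valBound-a (suc (suc i)) (suc (suc j))))
    (≤-by-identity (5 + 6 * i) (solve (i ∷ j ∷ q ∷ [])))

b-step : ∀ {n p q p′} → odd (suc n) ≡ true → RowBound 6 (suc n) p q →
         q + 2 ≤ 2 * p → p′ ≤ p + 4 → 2 * p′ ≤ 14 + q → RowBound 9 (suc (suc n)) p′ (8 + q)
head (b-step {n} {p} {q} {p′} odd row q+2≤2p p′≤p+4 2p′≤14+q) = ∣-x-b-step n 1 odd term
  where
  term : ∀ i → 3 ^ p′ ∣ x (suc n) (suc i) * b (suc i) 1
  term zero = 3^∣ (valBound-* (∣⇒valBound p (head row)) (∣⇒valBound 4 (divides 2 refl))) p′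
    (≤-by-certificate (*-mono-≤ (≤-refl {2}) p′≤p+4) 1 (solve (p ∷ p′ ∷ [])))
  term 1 = 3^∣ (valBound-* (tail row 0) (∣⇒valBound 1 (divides 10 refl))) p′
    (≤-by-certificate 2p′≤14+q 0 (solve (p′ ∷ q ∷ [])))
  term (suc (suc i)) = ∣m⇒∣m*n _ (3^∣ (tail row (suc i)) p′
    (≤-by-certificate 2p′≤14+q (7 + 9 * i) (solve (i ∷ p′ ∷ q ∷ []))))
3^∣ (tail (b-step {n} {p} {q} odd row q+2≤2p _ _) j) e h =
  ∣-x-b-step n (suc (suc j)) odd λ i → 3^∣ (term i) e h
  where
  term : ∀ i → ValBound 9 (9 * suc (suc j) + (8 + q)) (x (suc n) (suc i) * b (suc i) (suc (suc j)))
  term zero = valBound-weaken (valBound-* (∣⇒valBound p (head row)) (valBound-b 0 (suc (suc j))))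
    (≤-by-certificate q+2≤2p 0 (solve (j ∷ p ∷ q ∷ [])))
  term (suc i) = valBound-weaken (valBound-* (tail row i) (valBound-b (suc i) (suc (suc j))))
    (≤-by-identity (6 + 6 * i) (solve (i ∷ j ∷ q ∷ [])))

row₁ : RowBound 6 1 1 0
head row₁ = ∣-refl
tail row₁ _ = valBound-0

≤-by-computation : ∀ {m n} {m≤ᵇn : T (m ≤ᵇ n)} → m ≤ n
≤-by-computation {m} {n} {m≤ᵇn} = ≤ᵇ⇒≤ m n m≤ᵇn

-- Before row 6 the bound on x_{n,1} grows faster than the uniform pattern.
row₂ : RowBound 9 2 5 8
row₂ = b-step refl row₁ ≤-by-computation ≤-by-computation ≤-by-computation

row₃ : RowBound 6 3 6 8
row₃ = a-step refl row₂ ≤-by-computation ≤-by-computation ≤-by-computation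

row₄ : RowBound 9 4 10 16
row₄ = b-step refl row₃ ≤-by-computation ≤-by-computation ≤-by-computation

row₅ : RowBound 6 5 11 16
row₅ = a-step refl row₄ ≤-by-computation ≤-by-computation ≤-by-computation

row₆ : RowBound 9 6 15 24
row₆ = b-step refl row₅ ≤-by-computation ≤-by-computation ≤-by-computation

odd-2* : ∀ k → odd (2 * k) ≡ false
odd-2* zero = refl
odd-2* (suc k) = trans (cong odd (*-suc 2 k)) (odd-2* k)

odd-1+2* : ∀ k → odd (suc (2 * k)) ≡ true
odd-1+2* zero = refl
odd-1+2* (suc k) = trans (cong (odd ∘ suc) (*-suc 2 k)) (odd-1+2* k)

even-row : ∀ t → RowBound 9 (2 * (3 + t)) (4 * (3 + t) + 3) ((3 + t) * 8)
odd-row : ∀ t → RowBound 6 (suc (2 * (3 + t))) (4 * (3 + t) + 4) ((3 + t) * 8)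
even-row zero = row₆
even-row (suc t) =
  subst (λ n → RowBound 9 n (4 * (4 + t) + 3) ((4 + t) * 8)) (sym (*-suc 2 (3 + t)))
    (b-step (odd-1+2* (3 + t)) (odd-row t)
      (≤-by-identity 6 (solve (t ∷ [])))
      (≤-by-identity 1 (solve (t ∷ [])))
      (≤-by-identity 0 (solve (t ∷ []))))
odd-row t = a-step (odd-2* (3 + t)) (even-row t)
  (≤-by-identity 6 (solve (t ∷ [])))
  (≤-by-identity 0 (solve (t ∷ [])))
  (≤-by-identity 1 (solve (t ∷ [])))

lemma2p6 : (k : ℕ) → 3 ≤ k →
    (3 ^ (4 * k + 3) ∣ x (2 * k) 1) × (3 ^ (4 * k + 4) ∣ x (2 * k + 1) 1)
lemma2p6 k 3≤k with m≤n⇒∃[o]m+o≡n 3≤k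
... | t , refl = head (even-row t)
               , subst (λ n → 3 ^ (4 * k + 4) ∣ x n 1) (+-comm 1 (2 * k)) (head (odd-row t))
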